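{- Let $\mathcal{M}$ be a simple matroid on $[n]$, let $\mathbb{K}$ be a field, and let $\ell\ge4$. If $\mathcal{M}$ is $\ell$-chordal, then the Orlik–Solomon algebra $\operatorname{OS}(\mathcal{M})$ is $(\ell-2)$-adic, i.e. $\Im(\mathfrak{C})=\Im(\mathfrak{C}_{\ell-1})$.
   Context: $\mathcal{E}=\bigwedge\big(\bigoplus_{i=1}^n\mathbb{K}e_i\big)$; $e_X=e_{i_1}\wedge\dots\wedge e_{i_m}$ for $X=\{i_1<\dots<i_m\}$; $\partial$ is the degree $-1$ derivation with $\partial(e_i)=1$ and $\partial(a\wedge b)=\partial(a)\wedge b+(-1)^{\deg a}a\wedge\partial(b)$. For $\mathfrak{X}\subseteq2^{[n]}$, $\Im(\mathfrak{X})$ is the two-sided ideal generated by $\{\partial(e_X):X\in\mathfrak{X}\}$. $\mathfrak{C}$ is the set of circuits of $\mathcal{M}$ and $\mathfrak{C}_k$ the set of circuits with at most $k$ elements. $\operatorname{OS}(\mathcal{M})=\mathcal{E}/\Im(\mathfrak{C})$; it is called $m$-adic if $\Im(\mathfrak{C})=\Im(\mathfrak{C}_{m+1})$ (quadratic when $m=2$). A circuit $C$ has a chord $i_\alpha$ if there are circuits $C_1,C_2$ with $C_1\cap C_2=\{i_\alpha\}$ and $C=C_1\Delta C_2$; $\mathcal{M}$ is $\ell$-chordal if every circuit with at least $\ell$ elements has a chord. -}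

module Defs where

open import Level using (Level; _⊔_) renaming (suc to lsuc; zero to lzero)
open import Data.Nat using (ℕ; zero; suc; _≤_; _∸_)
import Data.Nat as ℕ
open import Data.Bool using (Bool; true; false; if_then_else_)
import Data.Bool as Bool
open import Data.Fin using (Fin; zero; suc)
open import Data.Fin.Subset using (Subset; _∈_; _⊆_; _∩_; _∪_; _─_; _-_; ⁅_⁆; ∣_∣; ⊥; inside; outside)
open import Data.Vec using (Vec; []; _∷_; lookup)
open import Data.Vec.Properties using (≡-dec)
open import Data.List using (List; []; _∷_; _++_; map; foldr; allFin; concatMap)
open import Data.Product using (Σ; ∃; _×_; _,_)
open import Relation.Nullary using (¬_; yes; no)
open import Relation.Binary.PropositionalEquality using (_≡_)
open import Algebra.Bundles using (CommutativeRing)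

record Field (c ℓ : Level) : Set (lsuc (c ⊔ ℓ)) where
  field
    commutativeRing : CommutativeRing c ℓ
  open CommutativeRing commutativeRing public
  field
    1≉0     : ¬ (1# ≈ 0#)
    inverse : ∀ x → ¬ (x ≈ 0#) → ∃ λ y → x * y ≈ 1#

_Δ_ : ∀ {n} → Subset n → Subset n → Subset n
A Δ B = (A ─ B) ∪ (B ─ A)

_≟ₛ_ : ∀ {n} (A B : Subset n) → Relation.Nullary.Dec (A ≡ B)
_≟ₛ_ = ≡-dec Bool._≟_

allSubsets : ∀ n → List (Subset n)
allSubsets zero    = [] ∷ []
allSubsets (suc n) = map (inside ∷_) (allSubsets n) ++ map (outside ∷_) (allSubsets n)

-- number of pairs (i , j) with i ∈ X, j ∈ Y and j < i
-- (the number of transpositions needed to sort e_X ∧ e_Y)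
inversions : ∀ {n} → Subset n → Subset n → ℕ
inversions []      []      = 0
inversions (x ∷ X) (y ∷ Y) = (if y then ∣ X ∣ else 0) ℕ.+ inversions X Y

below : ∀ {n} → Fin n → Subset n → ℕ
below zero    (x ∷ X) = 0
below (suc i) (x ∷ X) = (if x then 1 else 0) ℕ.+ below i X

disjoint? : ∀ {n} → Subset n → Subset n → Bool
disjoint? []      []      = true
disjoint? (x ∷ X) (y ∷ Y) = Bool.not (x Bool.∧ y) Bool.∧ disjoint? X Y

record Matroid (n : ℕ) : Set₁ where
  field
    IsCircuit   : Subset n → Set
    empty-not   : ¬ IsCircuit ⊥
    incomparable : ∀ {C₁ C₂} → IsCircuit C₁ → IsCircuit C₂ → C₁ ⊆ C₂ → C₁ ≡ C₂
    elimination : ∀ {C₁ C₂ e} → IsCircuit C₁ → IsCircuit C₂ → ¬ (C₁ ≡ C₂) →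
                  e ∈ C₁ ∩ C₂ → ∃ λ C₃ → IsCircuit C₃ × C₃ ⊆ (C₁ ∪ C₂) - e

module _ {n : ℕ} (M : Matroid n) where
  open Matroid M

  -- simple: no loops and no parallel elements, i.e. every circuit has ≥ 3 elements
  Simple : Set
  Simple = ∀ C → IsCircuit C → 3 ≤ ∣ C ∣

  CircuitsUpTo : ℕ → Subset n → Set
  CircuitsUpTo k C = IsCircuit C × ∣ C ∣ ≤ k

  HasChord : Subset n → Set
  HasChord C = ∃ λ (i : Fin n) → ∃ λ C₁ → ∃ λ C₂ →
    IsCircuit C₁ × IsCircuit C₂ × C₁ ∩ C₂ ≡ ⁅ i ⁆ × C ≡ C₁ Δ C₂

  Chordal : ℕ → Set
  Chordal ℓ = ∀ C → IsCircuit C → ℓ ≤ ∣ C ∣ → HasChord C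

-- The exterior algebra E = ⋀(⊕ K e_i), elements = coefficient functions
-- on the basis {e_X : X ⊆ [n]}.

module Exterior {c ℓ : Level} (K : Field c ℓ) (n : ℕ) where
  open Field K

  E : Set c
  E = Subset n → Carrier

  _≈ᴱ_ : E → E → Set ℓ
  a ≈ᴱ b = ∀ X → a X ≈ b X

  0ᴱ : E
  0ᴱ _ = 0#

  _+ᴱ_ : E → E → E
  (a +ᴱ b) X = a X + b X

  _·ᴱ_ : Carrier → E → E
  (r ·ᴱ a) X = r * a X

  sumᴱ : List E → E
  sumᴱ = foldr _+ᴱ_ 0ᴱ

  sgn : ℕ → Carrier
  sgn zero    = 1#
  sgn (suc k) = - sgn k

  e : Subset n → E
  e X Z with Z ≟ₛ X
  ... | yes _ = 1#
  ... | no  _ = 0#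

  eWedge : Subset n → Subset n → E
  eWedge X Y = if disjoint? X Y then sgn (inversions X Y) ·ᴱ e (X ∪ Y) else 0ᴱ

  _∧ᴱ_ : E → E → E
  a ∧ᴱ b = sumᴱ (concatMap (λ X → map (λ Y → (a X * b Y) ·ᴱ eWedge X Y)
                                       (allSubsets n)) (allSubsets n))

  -- ∂(e_X) = Σ_{k} (-1)^{k-1} e_{X ∖ {i_k}}  (X = {i_1 < … < i_m}),
  -- the value on e_X of the degree -1 derivation with ∂(e_i) = 1
  ∂e : Subset n → E
  ∂e X = sumᴱ (map (λ i → if lookup X i then sgn (below i X) ·ᴱ e (X ─ ⁅ i ⁆) else 0ᴱ)
                   (allFin n))

  data Ideal (𝔛 : Subset n → Set) : E → Set (c ⊔ ℓ) where
    gen  : ∀ {X} → 𝔛 X → Ideal 𝔛 (∂e X)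
    zer  : Ideal 𝔛 0ᴱ
    add  : ∀ {a b} → Ideal 𝔛 a → Ideal 𝔛 b → Ideal 𝔛 (a +ᴱ b)
    lmul : ∀ {b} a → Ideal 𝔛 b → Ideal 𝔛 (a ∧ᴱ b)
    rmul : ∀ {a} b → Ideal 𝔛 a → Ideal 𝔛 (a ∧ᴱ b)
    resp : ∀ {a b} → a ≈ᴱ b → Ideal 𝔛 a → Ideal 𝔛 b

  SameIdeal : (Subset n → Set) → (Subset n → Set) → Set (c ⊔ ℓ)
  SameIdeal 𝔛 𝔜 = ∀ a → (Ideal 𝔛 a → Ideal 𝔜 a) × (Ideal 𝔜 a → Ideal 𝔛 a)

{-# OPTIONS --safe #-}
-- Write a circuit with a chord as C = C₁ Δ C₂ with C₁ ∩ C₂ = {i}, and put A = C₁ ∖ i,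
-- B = C₂ ∖ i. For the degree -1 derivation ∂ of the exterior algebra and w = e_i, which
-- satisfies ∂w = 1 and α(w) = -w for the grade involution α, the Leibniz rule
-- ∂(u ∧ v) = ∂u ∧ v + α(u) ∧ ∂v gives
--   ∂(u ∧ v) = ∂u ∧ ∂(w ∧ v) + ∂(u ∧ w) ∧ ∂v.
-- For u = e_A and v = e_B this puts ∂e_C = ±∂(e_A ∧ e_B) into the ideal generated by
-- ∂e_{C₁} = ±∂(e_A ∧ e_i) and ∂e_{C₂} = ±∂(e_i ∧ e_B). Since |C| + 2 = |C₁| + |C₂| and
-- circuits of a simple matroid have at least 3 elements, C₁ and C₂ are smaller than C,
-- so induction on |C| reduces every circuit to circuits with at most ℓ - 1 elements.
-- The product, α and ∂ are computed recursively along E_{n+1} = E_n ⊕ e₀ ∧ E_n.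
module Submission where

open import Defs
open import Level using (Level)
open import Data.Nat as ℕ using (ℕ; zero; suc; _≤_; _<_; _∸_)
open import Data.Nat.Properties as ℕ using (≤-refl; ≤-trans; ≰⇒>; m≤n+m∸n)
open import Data.Nat.Induction using (<-wellFounded)
open import Data.Bool using (Bool; true; false; if_then_else_)
open import Data.Fin using (Fin; zero; suc; #_)
open import Data.Fin.Subset using (Subset; inside; outside; ∣_∣; ⁅_⁆; _─_; _∪_; _∩_; ⊥)
open import Data.Fin.Subset.Properties using (∣⊥∣≡0; ∣⁅x⁆∣≡1; p─⊥≡p)
open import Data.Vec using ([]; _∷_; lookup)
open import Data.Vec.Properties using (∷-injectiveˡ; ∷-injectiveʳ)
open import Data.List using (List; []; _∷_; _++_; map; concatMap; allFin)
open import Data.List.Properties using (map-tabulate)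
open import Data.Product using (_,_; proj₁)
open import Function using (_∘_; id)
open import Induction.WellFounded using (module All)
open import Relation.Binary.Construct.On using (wellFounded)
open import Relation.Binary.PropositionalEquality as ≡ using (_≡_)
open import Relation.Nullary using (¬_; Dec; yes; no; contradiction)

split-∩ˡ : ∀ {n} (p q : Subset n) → p ≡ (p ─ (p ∩ q)) ∪ (p ∩ q)
split-∩ˡ []           []           = ≡.refl
split-∩ˡ (inside ∷ p)  (inside ∷ q)  = ≡.cong (inside ∷_) (split-∩ˡ p q)
split-∩ˡ (inside ∷ p)  (outside ∷ q) = ≡.cong (inside ∷_) (split-∩ˡ p q)
split-∩ˡ (outside ∷ p) (inside ∷ q)  = ≡.cong (outside ∷_) (split-∩ˡ p q)
split-∩ˡ (outside ∷ p) (outside ∷ q) = ≡.cong (outside ∷_) (split-∩ˡ p q)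

split-∩ʳ : ∀ {n} (p q : Subset n) → q ≡ (p ∩ q) ∪ (q ─ (p ∩ q))
split-∩ʳ []           []           = ≡.refl
split-∩ʳ (inside ∷ p)  (inside ∷ q)  = ≡.cong (inside ∷_) (split-∩ʳ p q)
split-∩ʳ (inside ∷ p)  (outside ∷ q) = ≡.cong (outside ∷_) (split-∩ʳ p q)
split-∩ʳ (outside ∷ p) (inside ∷ q)  = ≡.cong (inside ∷_) (split-∩ʳ p q)
split-∩ʳ (outside ∷ p) (outside ∷ q) = ≡.cong (outside ∷_) (split-∩ʳ p q)

split-Δ : ∀ {n} (p q : Subset n) → p Δ q ≡ (p ─ (p ∩ q)) ∪ (q ─ (p ∩ q))
split-Δ []           []           = ≡.refl
split-Δ (inside ∷ p)  (inside ∷ q)  = ≡.cong (outside ∷_) (split-Δ p q)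
split-Δ (inside ∷ p)  (outside ∷ q) = ≡.cong (inside ∷_) (split-Δ p q)
split-Δ (outside ∷ p) (inside ∷ q)  = ≡.cong (inside ∷_) (split-Δ p q)
split-Δ (outside ∷ p) (outside ∷ q) = ≡.cong (outside ∷_) (split-Δ p q)

disjoint-─∩-∩ : ∀ {n} (p q : Subset n) → disjoint? (p ─ (p ∩ q)) (p ∩ q) ≡ true
disjoint-─∩-∩ []           []           = ≡.refl
disjoint-─∩-∩ (inside ∷ p)  (inside ∷ q)  = disjoint-─∩-∩ p q
disjoint-─∩-∩ (inside ∷ p)  (outside ∷ q) = disjoint-─∩-∩ p q
disjoint-─∩-∩ (outside ∷ p) (inside ∷ q)  = disjoint-─∩-∩ p q
disjoint-─∩-∩ (outside ∷ p) (outside ∷ q) = disjoint-─∩-∩ p q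

disjoint-∩-─∩ : ∀ {n} (p q : Subset n) → disjoint? (p ∩ q) (q ─ (p ∩ q)) ≡ true
disjoint-∩-─∩ []           []           = ≡.refl
disjoint-∩-─∩ (inside ∷ p)  (inside ∷ q)  = disjoint-∩-─∩ p q
disjoint-∩-─∩ (inside ∷ p)  (outside ∷ q) = disjoint-∩-─∩ p q
disjoint-∩-─∩ (outside ∷ p) (inside ∷ q)  = disjoint-∩-─∩ p q
disjoint-∩-─∩ (outside ∷ p) (outside ∷ q) = disjoint-∩-─∩ p q

disjoint-─∩-─∩ : ∀ {n} (p q : Subset n) → disjoint? (p ─ (p ∩ q)) (q ─ (p ∩ q)) ≡ true
disjoint-─∩-─∩ []           []           = ≡.refl
disjoint-─∩-─∩ (inside ∷ p)  (inside ∷ q)  = disjoint-─∩-─∩ p q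
disjoint-─∩-─∩ (inside ∷ p)  (outside ∷ q) = disjoint-─∩-─∩ p q
disjoint-─∩-─∩ (outside ∷ p) (inside ∷ q)  = disjoint-─∩-─∩ p q
disjoint-─∩-─∩ (outside ∷ p) (outside ∷ q) = disjoint-─∩-─∩ p q

∣pΔq∣+2∣p∩q∣≡∣p∣+∣q∣ : ∀ {n} (p q : Subset n) →
  ∣ p Δ q ∣ ℕ.+ (∣ p ∩ q ∣ ℕ.+ ∣ p ∩ q ∣) ≡ ∣ p ∣ ℕ.+ ∣ q ∣
∣pΔq∣+2∣p∩q∣≡∣p∣+∣q∣ []           []           = ≡.refl
∣pΔq∣+2∣p∩q∣≡∣p∣+∣q∣ (inside ∷ p)  (inside ∷ q)  = begin
  ∣ p Δ q ∣ ℕ.+ (suc k ℕ.+ suc k)        ≡⟨ ≡.cong (∣ p Δ q ∣ ℕ.+_) (≡.cong suc (ℕ.+-suc k k)) ⟩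
  ∣ p Δ q ∣ ℕ.+ suc (suc (k ℕ.+ k))      ≡⟨ ℕ.+-suc ∣ p Δ q ∣ _ ⟩
  suc (∣ p Δ q ∣ ℕ.+ suc (k ℕ.+ k))      ≡⟨ ≡.cong suc (ℕ.+-suc ∣ p Δ q ∣ _) ⟩
  suc (suc (∣ p Δ q ∣ ℕ.+ (k ℕ.+ k)))    ≡⟨ ≡.cong (2 ℕ.+_) (∣pΔq∣+2∣p∩q∣≡∣p∣+∣q∣ p q) ⟩
  suc (suc (∣ p ∣ ℕ.+ ∣ q ∣))            ≡⟨ ≡.cong suc (ℕ.+-suc ∣ p ∣ ∣ q ∣) ⟨
  suc ∣ p ∣ ℕ.+ suc ∣ q ∣                ∎
  where
  open ≡.≡-Reasoning
  k = ∣ p ∩ q ∣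
∣pΔq∣+2∣p∩q∣≡∣p∣+∣q∣ (inside ∷ p)  (outside ∷ q) = ≡.cong suc (∣pΔq∣+2∣p∩q∣≡∣p∣+∣q∣ p q)
∣pΔq∣+2∣p∩q∣≡∣p∣+∣q∣ (outside ∷ p) (inside ∷ q)  =
  ≡.trans (≡.cong suc (∣pΔq∣+2∣p∩q∣≡∣p∣+∣q∣ p q)) (≡.sym (ℕ.+-suc ∣ p ∣ ∣ q ∣))
∣pΔq∣+2∣p∩q∣≡∣p∣+∣q∣ (outside ∷ p) (outside ∷ q) = ∣pΔq∣+2∣p∩q∣≡∣p∣+∣q∣ p q

m+n≡o+2∧3≤n⇒m<o : ∀ {m n o} → m ℕ.+ n ≡ o ℕ.+ 2 → 3 ≤ n → m < o
m+n≡o+2∧3≤n⇒m<o {m} {n} {o} eq 3≤n = ℕ.+-cancelʳ-< 2 m o (begin-strict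
  m ℕ.+ 2  <⟨ ℕ.+-monoʳ-< m ≤-refl ⟩
  m ℕ.+ 3  ≤⟨ ℕ.+-monoʳ-≤ m 3≤n ⟩
  m ℕ.+ n  ≡⟨ eq ⟩
  o ℕ.+ 2  ∎)
  where open ℕ.≤-Reasoning

module _ {n} {p q : Subset n} {i : Fin n} (p∩q≡i : p ∩ q ≡ ⁅ i ⁆) where

  ∣p∣+∣q∣≡∣pΔq∣+2 : ∣ p ∣ ℕ.+ ∣ q ∣ ≡ ∣ p Δ q ∣ ℕ.+ 2
  ∣p∣+∣q∣≡∣pΔq∣+2 = ≡.trans (≡.sym (∣pΔq∣+2∣p∩q∣≡∣p∣+∣q∣ p q))
    (≡.cong (λ k → ∣ p Δ q ∣ ℕ.+ (k ℕ.+ k)) (≡.trans (≡.cong ∣_∣ p∩q≡i) (∣⁅x⁆∣≡1 i)))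

  ∣p∣<∣pΔq∣ : 3 ≤ ∣ q ∣ → ∣ p ∣ < ∣ p Δ q ∣
  ∣p∣<∣pΔq∣ = m+n≡o+2∧3≤n⇒m<o ∣p∣+∣q∣≡∣pΔq∣+2

  ∣q∣<∣pΔq∣ : 3 ≤ ∣ p ∣ → ∣ q ∣ < ∣ p Δ q ∣
  ∣q∣<∣pΔq∣ = m+n≡o+2∧3≤n⇒m<o (≡.trans (ℕ.+-comm ∣ q ∣ ∣ p ∣) ∣p∣+∣q∣≡∣pΔq∣+2)

module ExteriorCalculus {c ℓ′} (K : Field c ℓ′) where
  open Field K hiding (zero)
  open import Algebra.Properties.Ring ring
    using (-‿distribˡ-*; -‿distribʳ-*; -1*x≈-x; -‿involutive; -‿+-comm; -0#≈0#)
  open import Algebra.Properties.CommutativeSemigroup +-commutativeSemigroup using (interchange)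
  import Algebra.Solver.CommutativeMonoid +-commutativeMonoid as +-Solver
  open import Relation.Binary.Reasoning.Setoid setoid

  module Ext {n : ℕ} = Exterior K n
  open Ext using (_≈ᴱ_; 0ᴱ; _+ᴱ_; _·ᴱ_; e; eWedge; _∧ᴱ_; ∂e; Ideal; gen; add; lmul; rmul; resp)

  E : ℕ → Set c
  E n = Subset n → Carrier

  -ᴱ_ : ∀ {n} → E n → E n
  (-ᴱ a) X = - a X

  ≈ᴱ-refl : ∀ {n} {a : E n} → a ≈ᴱ a
  ≈ᴱ-refl X = refl

  x≈0⇒y*x≈0 : ∀ {x} y → x ≈ 0# → y * x ≈ 0#
  x≈0⇒y*x≈0 y x≈0 = trans (*-cong refl x≈0) (zeroʳ y)

  -x*-y≈x*y : ∀ x y → - x * - y ≈ x * y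
  -x*-y≈x*y x y = begin
    - x * - y     ≈⟨ -‿distribˡ-* x (- y) ⟨
    - (x * - y)   ≈⟨ -‿cong (-‿distribʳ-* x y) ⟨
    - - (x * y)   ≈⟨ -‿involutive _ ⟩
    x * y         ∎

  -- Exterior.sgn, without its nominal dependence on n.
  sign : ℕ → Carrier
  sign zero    = 1#
  sign (suc k) = - sign k

  sgn≈sign : ∀ {n} k → Ext.sgn {n} k ≈ sign k
  sgn≈sign zero    = refl
  sgn≈sign (suc k) = -‿cong (sgn≈sign k)

  sgn-indep : ∀ {m n} k → Ext.sgn {m} k ≈ Ext.sgn {n} k
  sgn-indep k = trans (sgn≈sign k) (sym (sgn≈sign k))

  sign-+ : ∀ m k → sign (m ℕ.+ k) ≈ sign m * sign k
  sign-+ zero    k = sym (*-identityˡ _)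
  sign-+ (suc m) k = trans (-‿cong (sign-+ m k)) (-‿distribˡ-* _ _)

  sign*sign≈1 : ∀ k → sign k * sign k ≈ 1#
  sign*sign≈1 zero    = *-identityˡ 1#
  sign*sign≈1 (suc k) = trans (-x*-y≈x*y _ _) (sign*sign≈1 k)

  sumMap : ∀ {a} {A : Set a} → (A → Carrier) → List A → Carrier
  sumMap f []       = 0#
  sumMap f (x ∷ xs) = f x + sumMap f xs

  module _ {a} {A : Set a} where

    sumMap-cong : ∀ {f g : A → Carrier} xs → (∀ x → f x ≈ g x) → sumMap f xs ≈ sumMap g xs
    sumMap-cong []       f≈g = refl
    sumMap-cong (x ∷ xs) f≈g = +-cong (f≈g x) (sumMap-cong xs f≈g)

    sumMap-zero : ∀ {f : A → Carrier} xs → (∀ x → f x ≈ 0#) → sumMap f xs ≈ 0#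
    sumMap-zero []       f≈0 = refl
    sumMap-zero (x ∷ xs) f≈0 = trans (+-cong (f≈0 x) (sumMap-zero xs f≈0)) (+-identityˡ 0#)

    sumMap-+ : ∀ (f g : A → Carrier) xs → sumMap (λ x → f x + g x) xs ≈ sumMap f xs + sumMap g xs
    sumMap-+ f g []       = sym (+-identityʳ 0#)
    sumMap-+ f g (x ∷ xs) = trans (+-cong refl (sumMap-+ f g xs)) (interchange _ _ _ _)

    sumMap-*ˡ : ∀ r (f : A → Carrier) xs → sumMap (λ x → r * f x) xs ≈ r * sumMap f xs
    sumMap-*ˡ r f []       = sym (zeroʳ r)
    sumMap-*ˡ r f (x ∷ xs) = trans (+-cong refl (sumMap-*ˡ r f xs)) (sym (distribˡ r _ _))

    sumMap-++ : ∀ (f : A → Carrier) xs ys → sumMap f (xs ++ ys) ≈ sumMap f xs + sumMap f ys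
    sumMap-++ f []       ys = sym (+-identityˡ _)
    sumMap-++ f (x ∷ xs) ys = trans (+-cong refl (sumMap-++ f xs ys)) (sym (+-assoc _ _ _))

  sumMap-map : ∀ {a b} {A : Set a} {B : Set b} (f : B → Carrier) (g : A → B) xs → sumMap f (map g xs) ≡ sumMap (f ∘ g) xs
  sumMap-map f g []       = ≡.refl
  sumMap-map f g (x ∷ xs) = ≡.cong (f (g x) +_) (sumMap-map f g xs)

  sumMap-concatMap : ∀ {a b} {A : Set a} {B : Set b} (f : B → Carrier) (h : A → List B) xs →
    sumMap f (concatMap h xs) ≈ sumMap (λ x → sumMap f (h x)) xs
  sumMap-concatMap f h []       = refl
  sumMap-concatMap f h (x ∷ xs) =
    trans (sumMap-++ f (h x) (concatMap h xs)) (+-cong refl (sumMap-concatMap f h xs))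

  sumMap-allFin-suc : ∀ {n} (f : Fin (suc n) → Carrier) →
    sumMap f (allFin (suc n)) ≡ f zero + sumMap (f ∘ suc) (allFin n)
  sumMap-allFin-suc {n} f = ≡.cong (f zero +_)
    (≡.trans (≡.cong (sumMap f) (≡.sym (map-tabulate id suc))) (sumMap-map f suc (allFin n)))

  sumᴱ-at : ∀ {n} (as : List (E n)) Z → Ext.sumᴱ as Z ≡ sumMap (λ a → a Z) as
  sumᴱ-at []       Z = ≡.refl
  sumᴱ-at (a ∷ as) Z = ≡.cong (a Z +_) (sumᴱ-at as Z)

  sumSubsets : ∀ {n} → (Subset n → Carrier) → Carrier
  sumSubsets {n} f = sumMap f (allSubsets n)

  sumSubsets-suc : ∀ {n} (f : Subset (suc n) → Carrier) →
    sumSubsets f ≈ sumSubsets (f ∘ (inside ∷_)) + sumSubsets (f ∘ (outside ∷_))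
  sumSubsets-suc {n} f = trans (sumMap-++ f (map (inside ∷_) (allSubsets n)) (map (outside ∷_) (allSubsets n)))
    (+-cong (reflexive (sumMap-map f _ (allSubsets n))) (reflexive (sumMap-map f _ (allSubsets n))))

  Σ² : ∀ {n} → (Subset n → Subset n → Carrier) → Carrier
  Σ² f = sumSubsets (λ X → sumSubsets (f X))

  module _ {n : ℕ} where

    Σ²-cong : {f g : Subset n → Subset n → Carrier} → (∀ X Y → f X Y ≈ g X Y) → Σ² f ≈ Σ² g
    Σ²-cong f≈g = sumMap-cong (allSubsets n) (λ X → sumMap-cong (allSubsets n) (f≈g X))

    Σ²-zero : {f : Subset n → Subset n → Carrier} → (∀ X Y → f X Y ≈ 0#) → Σ² f ≈ 0#
    Σ²-zero f≈0 = sumMap-zero (allSubsets n) (λ X → sumMap-zero (allSubsets n) (f≈0 X))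

    Σ²-+ : (f g : Subset n → Subset n → Carrier) → Σ² (λ X Y → f X Y + g X Y) ≈ Σ² f + Σ² g
    Σ²-+ f g = trans (sumMap-cong (allSubsets n) (λ X → sumMap-+ (f X) (g X) (allSubsets n)))
                     (sumMap-+ _ _ (allSubsets n))

    Σ²-*ˡ : ∀ r (f : Subset n → Subset n → Carrier) → Σ² (λ X Y → r * f X Y) ≈ r * Σ² f
    Σ²-*ˡ r f = trans (sumMap-cong (allSubsets n) (λ X → sumMap-*ˡ r (f X) (allSubsets n)))
                      (sumMap-*ˡ r _ (allSubsets n))

  Σ²-suc : ∀ {n} (f : Subset (suc n) → Subset (suc n) → Carrier) →
    Σ² f ≈ (Σ² (λ X Y → f (inside ∷ X) (inside ∷ Y)) + Σ² (λ X Y → f (inside ∷ X) (outside ∷ Y)))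
         + (Σ² (λ X Y → f (outside ∷ X) (inside ∷ Y)) + Σ² (λ X Y → f (outside ∷ X) (outside ∷ Y)))
  Σ²-suc {n} f = begin
    Σ² f
      ≈⟨ sumSubsets-suc (λ X → sumSubsets (f X)) ⟩
    sumSubsets (λ X → sumSubsets (f (inside ∷ X))) + sumSubsets (λ X → sumSubsets (f (outside ∷ X)))
      ≈⟨ +-cong (sumMap-cong (allSubsets n) (λ X → sumSubsets-suc (f (inside ∷ X))))
                (sumMap-cong (allSubsets n) (λ X → sumSubsets-suc (f (outside ∷ X)))) ⟩
    _ ≈⟨ +-cong (sumMap-+ _ _ (allSubsets n)) (sumMap-+ _ _ (allSubsets n)) ⟩
    _ ∎

  ∧-as-Σ² : ∀ {n} (a b : E n) Z → (a ∧ᴱ b) Z ≈ Σ² (λ X Y → (a X * b Y) * eWedge X Y Z)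
  ∧-as-Σ² {n} a b Z = begin
    (a ∧ᴱ b) Z
      ≡⟨ sumᴱ-at (concatMap (λ X → map (term X) (allSubsets n)) (allSubsets n)) Z ⟩
    sumMap (λ t → t Z) (concatMap (λ X → map (term X) (allSubsets n)) (allSubsets n))
      ≈⟨ sumMap-concatMap _ _ (allSubsets n) ⟩
    sumSubsets (λ X → sumMap (λ t → t Z) (map (term X) (allSubsets n)))
      ≈⟨ sumMap-cong (allSubsets n) (λ X → reflexive (sumMap-map _ (term X) (allSubsets n))) ⟩
    Σ² (λ X Y → (a X * b Y) * eWedge X Y Z) ∎
    where
    term : Subset n → Subset n → E n
    term X Y = (a X * b Y) ·ᴱ eWedge X Y

  e-≡ : ∀ {n} (X Z : Subset n) → Z ≡ X → e X Z ≈ 1#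
  e-≡ X Z Z≡X with Z ≟ₛ X
  ... | yes _  = refl
  ... | no Z≢X = contradiction Z≡X Z≢X

  e-≢ : ∀ {n} (X Z : Subset n) → ¬ Z ≡ X → e X Z ≈ 0#
  e-≢ X Z Z≢X with Z ≟ₛ X
  ... | yes Z≡X = contradiction Z≡X Z≢X
  ... | no _    = refl

  e-∷ : ∀ {n} b (X Z : Subset n) → e (b ∷ X) (b ∷ Z) ≈ e X Z
  e-∷ b X Z = on (Z ≟ₛ X)
    where
    on : Dec (Z ≡ X) → e (b ∷ X) (b ∷ Z) ≈ e X Z
    on (yes Z≡X) = trans (e-≡ (b ∷ X) (b ∷ Z) (≡.cong (b ∷_) Z≡X)) (sym (e-≡ X Z Z≡X))
    on (no Z≢X)  = trans (e-≢ (b ∷ X) (b ∷ Z) (Z≢X ∘ ∷-injectiveʳ)) (sym (e-≢ X Z Z≢X))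

  e-∷-≢ : ∀ {n} b b′ (X Z : Subset n) → ¬ b′ ≡ b → e (b ∷ X) (b′ ∷ Z) ≈ 0#
  e-∷-≢ b b′ X Z b′≢b = e-≢ (b ∷ X) (b′ ∷ Z) (b′≢b ∘ ∷-injectiveˡ)

  -- Both eWedge X Y and the summands of ∂e X have this shape.
  guardedBasis : ∀ {n} → Bool → Carrier → Subset n → E n
  guardedBasis d s V = if d then s ·ᴱ e V else 0ᴱ

  guardedBasis-∷ : ∀ {n} d s b (V Z : Subset n) → guardedBasis d s (b ∷ V) (b ∷ Z) ≈ guardedBasis d s V Z
  guardedBasis-∷ true  s b V Z = *-cong refl (e-∷ b V Z)
  guardedBasis-∷ false s b V Z = refl

  guardedBasis-∷-≢ : ∀ {n} d s b b′ (V Z : Subset n) → ¬ b′ ≡ b → guardedBasis d s (b ∷ V) (b′ ∷ Z) ≈ 0#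
  guardedBasis-∷-≢ true  s b b′ V Z b′≢b = x≈0⇒y*x≈0 s (e-∷-≢ b b′ V Z b′≢b)
  guardedBasis-∷-≢ false s b b′ V Z b′≢b = refl

  guardedBasis-* : ∀ {n} d s t (V Z : Subset n) → guardedBasis d (s * t) V Z ≈ s * guardedBasis d t V Z
  guardedBasis-* true  s t V Z = *-assoc s t _
  guardedBasis-* false s t V Z = sym (zeroʳ s)

  guardedBasis-cong : ∀ {n} d {s t} (V Z : Subset n) → s ≈ t → guardedBasis d s V Z ≈ guardedBasis d t V Z
  guardedBasis-cong true  V Z s≈t = *-cong s≈t refl
  guardedBasis-cong false V Z s≈t = refl

  eWedge-∷-outside : ∀ {n} x (X Y Z : Subset n) → eWedge (x ∷ X) (outside ∷ Y) (x ∷ Z) ≈ eWedge X Y Z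
  eWedge-∷-outside {n} inside  X Y Z = trans (guardedBasis-∷ (disjoint? X Y) (Ext.sgn {suc n} (inversions X Y)) inside (X ∪ Y) Z)
                                             (guardedBasis-cong (disjoint? X Y) (X ∪ Y) Z (sgn-indep {suc n} {n} (inversions X Y)))
  eWedge-∷-outside {n} outside X Y Z = trans (guardedBasis-∷ (disjoint? X Y) (Ext.sgn {suc n} (inversions X Y)) outside (X ∪ Y) Z)
                                             (guardedBasis-cong (disjoint? X Y) (X ∪ Y) Z (sgn-indep {suc n} {n} (inversions X Y)))

  eWedge-outside-inside : ∀ {n} (X Y Z : Subset n) →
    eWedge (outside ∷ X) (inside ∷ Y) (inside ∷ Z) ≈ sign ∣ X ∣ * eWedge X Y Z
  eWedge-outside-inside {n} X Y Z = begin
    guardedBasis d (Ext.sgn {suc n} (∣ X ∣ ℕ.+ inversions X Y)) (inside ∷ (X ∪ Y)) (inside ∷ Z)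
      ≈⟨ guardedBasis-∷ d _ inside (X ∪ Y) Z ⟩
    guardedBasis d (Ext.sgn {suc n} (∣ X ∣ ℕ.+ inversions X Y)) (X ∪ Y) Z
      ≈⟨ guardedBasis-cong d (X ∪ Y) Z sgn-split ⟩
    guardedBasis d (sign ∣ X ∣ * Ext.sgn {n} (inversions X Y)) (X ∪ Y) Z
      ≈⟨ guardedBasis-* d _ _ (X ∪ Y) Z ⟩
    sign ∣ X ∣ * eWedge X Y Z ∎
    where
    d = disjoint? X Y
    sgn-split : Ext.sgn {suc n} (∣ X ∣ ℕ.+ inversions X Y) ≈ sign ∣ X ∣ * Ext.sgn {n} (inversions X Y)
    sgn-split = trans (sgn≈sign {suc n} (∣ X ∣ ℕ.+ inversions X Y))
                      (trans (sign-+ ∣ X ∣ (inversions X Y)) (*-cong refl (sym (sgn≈sign {n} (inversions X Y)))))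

  -- a ∈ E (suc n) is part₀ a + e₀ ∧ part₁ a, for e₀ the generator of the first coordinate.
  part₀ part₁ : ∀ {n} → E (suc n) → E n
  part₀ a X = a (outside ∷ X)
  part₁ a X = a (inside ∷ X)

  α : ∀ {n} → E n → E n
  α a X = sign ∣ X ∣ * a X

  ∧-outside : ∀ {n} (a b : E (suc n)) Z → (a ∧ᴱ b) (outside ∷ Z) ≈ (part₀ a ∧ᴱ part₀ b) Z
  ∧-outside {n} a b Z = begin
    (a ∧ᴱ b) (outside ∷ Z) ≈⟨ ∧-as-Σ² a b (outside ∷ Z) ⟩
    Σ² F ≈⟨ Σ²-suc F ⟩
    (Σ² (λ X Y → F (inside ∷ X) (inside ∷ Y)) + Σ² (λ X Y → F (inside ∷ X) (outside ∷ Y)))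
      + (Σ² (λ X Y → F (outside ∷ X) (inside ∷ Y)) + Σ² (λ X Y → F (outside ∷ X) (outside ∷ Y)))
      ≈⟨ +-cong (+-cong (Σ²-zero {n} (λ X Y → zeroʳ _))
                        (Σ²-zero {n} (λ X Y → x≈0⇒y*x≈0 _ (guardedBasis-∷-≢ (disjoint? X Y) _ inside outside (X ∪ Y) Z λ ()))))
                (+-cong (Σ²-zero {n} (λ X Y → x≈0⇒y*x≈0 _ (guardedBasis-∷-≢ (disjoint? X Y) _ inside outside (X ∪ Y) Z λ ())))
                        (Σ²-cong {n} (λ X Y → *-cong refl (eWedge-∷-outside outside X Y Z)))) ⟩
    (0# + 0#) + (0# + Σ² (λ X Y → (part₀ a X * part₀ b Y) * eWedge X Y Z))
      ≈⟨ trans (+-cong (+-identityˡ 0#) (+-identityˡ _)) (+-identityˡ _) ⟩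
    Σ² (λ X Y → (part₀ a X * part₀ b Y) * eWedge X Y Z) ≈⟨ ∧-as-Σ² (part₀ a) (part₀ b) Z ⟨
    (part₀ a ∧ᴱ part₀ b) Z ∎
    where
    F : Subset (suc n) → Subset (suc n) → Carrier
    F X Y = (a X * b Y) * eWedge X Y (outside ∷ Z)

  ∧-inside : ∀ {n} (a b : E (suc n)) Z →
    (a ∧ᴱ b) (inside ∷ Z) ≈ (part₁ a ∧ᴱ part₀ b) Z + (α (part₀ a) ∧ᴱ part₁ b) Z
  ∧-inside {n} a b Z = begin
    (a ∧ᴱ b) (inside ∷ Z) ≈⟨ ∧-as-Σ² a b (inside ∷ Z) ⟩
    Σ² F ≈⟨ Σ²-suc F ⟩
    (Σ² (λ X Y → F (inside ∷ X) (inside ∷ Y)) + Σ² (λ X Y → F (inside ∷ X) (outside ∷ Y)))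
      + (Σ² (λ X Y → F (outside ∷ X) (inside ∷ Y)) + Σ² (λ X Y → F (outside ∷ X) (outside ∷ Y)))
      ≈⟨ +-cong (+-cong (Σ²-zero {n} (λ X Y → zeroʳ _))
                        (Σ²-cong {n} (λ X Y → *-cong refl (eWedge-∷-outside inside X Y Z))))
                (+-cong (Σ²-cong {n} (λ X Y → trans (*-cong refl (eWedge-outside-inside X Y Z)) (move-sign _ _ _ _)))
                        (Σ²-zero {n} (λ X Y → x≈0⇒y*x≈0 _ (guardedBasis-∷-≢ (disjoint? X Y) _ outside inside (X ∪ Y) Z λ ())))) ⟩
    (0# + Σ² (λ X Y → (part₁ a X * part₀ b Y) * eWedge X Y Z))
      + (Σ² (λ X Y → (α (part₀ a) X * part₁ b Y) * eWedge X Y Z) + 0#)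
      ≈⟨ +-cong (+-identityˡ _) (+-identityʳ _) ⟩
    Σ² (λ X Y → (part₁ a X * part₀ b Y) * eWedge X Y Z) + Σ² (λ X Y → (α (part₀ a) X * part₁ b Y) * eWedge X Y Z)
      ≈⟨ +-cong (∧-as-Σ² (part₁ a) (part₀ b) Z) (∧-as-Σ² (α (part₀ a)) (part₁ b) Z) ⟨
    (part₁ a ∧ᴱ part₀ b) Z + (α (part₀ a) ∧ᴱ part₁ b) Z ∎
    where
    F : Subset (suc n) → Subset (suc n) → Carrier
    F X Y = (a X * b Y) * eWedge X Y (inside ∷ Z)
    move-sign : ∀ p q s w → (p * q) * (s * w) ≈ ((s * p) * q) * w
    move-sign p q s w = begin
      (p * q) * (s * w) ≈⟨ *-assoc _ _ _ ⟨
      ((p * q) * s) * w ≈⟨ *-cong (*-comm _ _) refl ⟩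
      (s * (p * q)) * w ≈⟨ *-cong (*-assoc _ _ _) refl ⟨
      ((s * p) * q) * w ∎

  ∧-[] : ∀ (a b : E 0) → (a ∧ᴱ b) [] ≈ a [] * b []
  ∧-[] a b = begin
    (a ∧ᴱ b) [] ≈⟨ ∧-as-Σ² a b [] ⟩
    ((a [] * b []) * (1# * 1#) + 0#) + 0# ≈⟨ trans (+-identityʳ _) (+-identityʳ _) ⟩
    (a [] * b []) * (1# * 1#) ≈⟨ trans (*-cong refl (*-identityˡ 1#)) (*-identityʳ _) ⟩
    a [] * b [] ∎

  module _ {n : ℕ} where

    ∧-cong : {a a′ b b′ : E n} → a ≈ᴱ a′ → b ≈ᴱ b′ → (a ∧ᴱ b) ≈ᴱ (a′ ∧ᴱ b′)
    ∧-cong {a} {a′} {b} {b′} a≈a′ b≈b′ Z = trans (∧-as-Σ² a b Z)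
      (trans (Σ²-cong {n} (λ X Y → *-cong (*-cong (a≈a′ X) (b≈b′ Y)) refl)) (sym (∧-as-Σ² a′ b′ Z)))

    ∧-distribʳ : (a a′ b : E n) → ((a +ᴱ a′) ∧ᴱ b) ≈ᴱ ((a ∧ᴱ b) +ᴱ (a′ ∧ᴱ b))
    ∧-distribʳ a a′ b Z = trans (∧-as-Σ² _ b Z)
      (trans (Σ²-cong {n} (λ X Y → trans (*-cong (distribʳ (b Y) (a X) (a′ X)) refl) (distribʳ _ _ _)))
      (trans (Σ²-+ {n} _ _) (sym (+-cong (∧-as-Σ² a b Z) (∧-as-Σ² a′ b Z)))))

    ∧-distribˡ : (a b b′ : E n) → (a ∧ᴱ (b +ᴱ b′)) ≈ᴱ ((a ∧ᴱ b) +ᴱ (a ∧ᴱ b′))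
    ∧-distribˡ a b b′ Z = trans (∧-as-Σ² a _ Z)
      (trans (Σ²-cong {n} (λ X Y → trans (*-cong (distribˡ (a X) (b Y) (b′ Y)) refl) (distribʳ _ _ _)))
      (trans (Σ²-+ {n} _ _) (sym (+-cong (∧-as-Σ² a b Z) (∧-as-Σ² a b′ Z)))))

    ∧-scalarˡ : ∀ r (a b : E n) → ((r ·ᴱ a) ∧ᴱ b) ≈ᴱ (r ·ᴱ (a ∧ᴱ b))
    ∧-scalarˡ r a b Z = trans (∧-as-Σ² _ b Z)
      (trans (Σ²-cong {n} (λ X Y → trans (*-cong (*-assoc r (a X) (b Y)) refl) (*-assoc _ _ _)))
      (trans (Σ²-*ˡ {n} r _) (*-cong refl (sym (∧-as-Σ² a b Z)))))

    ∧-scalarʳ : ∀ r (a b : E n) → (a ∧ᴱ (r ·ᴱ b)) ≈ᴱ (r ·ᴱ (a ∧ᴱ b))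
    ∧-scalarʳ r a b Z = trans (∧-as-Σ² a _ Z)
      (trans (Σ²-cong {n} (λ X Y → trans (*-cong (x*[r*y]≈r*[x*y] _ _) refl) (*-assoc _ _ _)))
      (trans (Σ²-*ˡ {n} r _) (*-cong refl (sym (∧-as-Σ² a b Z)))))
      where
      x*[r*y]≈r*[x*y] : ∀ x y → x * (r * y) ≈ r * (x * y)
      x*[r*y]≈r*[x*y] x y = trans (sym (*-assoc x r y)) (trans (*-cong (*-comm x r) refl) (*-assoc r x y))

    ∧-negˡ : (a b : E n) → ((-ᴱ a) ∧ᴱ b) ≈ᴱ (-ᴱ (a ∧ᴱ b))
    ∧-negˡ a b Z = trans (∧-cong (λ X → sym (-1*x≈-x (a X))) ≈ᴱ-refl Z) (trans (∧-scalarˡ (- 1#) a b Z) (-1*x≈-x _))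

    ∧-negʳ : (a b : E n) → (a ∧ᴱ (-ᴱ b)) ≈ᴱ (-ᴱ (a ∧ᴱ b))
    ∧-negʳ a b Z = trans (∧-cong ≈ᴱ-refl (λ X → sym (-1*x≈-x (b X))) Z) (trans (∧-scalarʳ (- 1#) a b Z) (-1*x≈-x _))

    ∧-zeroˡ : (b : E n) → (0ᴱ ∧ᴱ b) ≈ᴱ 0ᴱ
    ∧-zeroˡ b Z = trans (∧-as-Σ² _ b Z) (Σ²-zero {n} (λ X Y → trans (*-cong (zeroˡ _) refl) (zeroˡ _)))

    ∧-zeroʳ : (a : E n) → (a ∧ᴱ 0ᴱ) ≈ᴱ 0ᴱ
    ∧-zeroʳ a Z = trans (∧-as-Σ² a _ Z) (Σ²-zero {n} (λ X Y → trans (*-cong (zeroʳ _) refl) (zeroˡ _)))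

    α-cong : {a b : E n} → a ≈ᴱ b → α a ≈ᴱ α b
    α-cong a≈b X = *-cong refl (a≈b X)

    α-zero : α {n} 0ᴱ ≈ᴱ 0ᴱ
    α-zero X = zeroʳ _

  part₁-α : ∀ {n} (a : E (suc n)) → part₁ (α a) ≈ᴱ (-ᴱ α (part₁ a))
  part₁-α a X = sym (-‿distribˡ-* _ _)

  α-∧ : ∀ {n} (a b : E n) → α (a ∧ᴱ b) ≈ᴱ (α a ∧ᴱ α b)
  α-∧ {zero} a b [] = begin
    1# * (a ∧ᴱ b) []     ≈⟨ *-identityˡ _ ⟩
    (a ∧ᴱ b) []          ≈⟨ ∧-[] a b ⟩
    a [] * b []          ≈⟨ *-cong (*-identityˡ _) (*-identityˡ _) ⟨
    α a [] * α b []      ≈⟨ ∧-[] (α a) (α b) ⟨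
    (α a ∧ᴱ α b) []      ∎
  α-∧ {suc n} a b (outside ∷ Z) = begin
    sign ∣ Z ∣ * (a ∧ᴱ b) (outside ∷ Z)  ≈⟨ *-cong refl (∧-outside a b Z) ⟩
    α (part₀ a ∧ᴱ part₀ b) Z            ≈⟨ α-∧ (part₀ a) (part₀ b) Z ⟩
    (α (part₀ a) ∧ᴱ α (part₀ b)) Z      ≈⟨ ∧-outside (α a) (α b) Z ⟨
    (α a ∧ᴱ α b) (outside ∷ Z)          ∎
  α-∧ {suc n} a b (inside ∷ Z) = begin
    (- sign ∣ Z ∣) * (a ∧ᴱ b) (inside ∷ Z)
      ≈⟨ *-cong refl (∧-inside a b Z) ⟩
    (- sign ∣ Z ∣) * ((part₁ a ∧ᴱ part₀ b) Z + (α (part₀ a) ∧ᴱ part₁ b) Z)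
      ≈⟨ -‿distribˡ-* _ _ ⟨
    - (sign ∣ Z ∣ * ((part₁ a ∧ᴱ part₀ b) Z + (α (part₀ a) ∧ᴱ part₁ b) Z))
      ≈⟨ -‿cong (distribˡ _ _ _) ⟩
    - (α (part₁ a ∧ᴱ part₀ b) Z + α (α (part₀ a) ∧ᴱ part₁ b) Z)
      ≈⟨ -‿cong (+-cong (α-∧ (part₁ a) (part₀ b) Z) (α-∧ (α (part₀ a)) (part₁ b) Z)) ⟩
    - ((α (part₁ a) ∧ᴱ α (part₀ b)) Z + (α (α (part₀ a)) ∧ᴱ α (part₁ b)) Z)
      ≈⟨ -‿+-comm _ _ ⟨
    - (α (part₁ a) ∧ᴱ α (part₀ b)) Z + - (α (α (part₀ a)) ∧ᴱ α (part₁ b)) Z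
      ≈⟨ +-cong (∧-negˡ (α (part₁ a)) (α (part₀ b)) Z) (∧-negʳ (α (α (part₀ a))) (α (part₁ b)) Z) ⟨
    ((-ᴱ α (part₁ a)) ∧ᴱ α (part₀ b)) Z + (α (α (part₀ a)) ∧ᴱ (-ᴱ α (part₁ b))) Z
      ≈⟨ +-cong (∧-cong (part₁-α a) ≈ᴱ-refl Z) (∧-cong ≈ᴱ-refl (part₁-α b) Z) ⟨
    (part₁ (α a) ∧ᴱ part₀ (α b)) Z + (α (part₀ (α a)) ∧ᴱ part₁ (α b)) Z
      ≈⟨ ∧-inside (α a) (α b) Z ⟨
    (α a ∧ᴱ α b) (inside ∷ Z) ∎

  ∧-assoc : ∀ {n} (a b c : E n) → ((a ∧ᴱ b) ∧ᴱ c) ≈ᴱ (a ∧ᴱ (b ∧ᴱ c))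
  ∧-assoc {zero} a b c [] = begin
    ((a ∧ᴱ b) ∧ᴱ c) []        ≈⟨ ∧-[] (a ∧ᴱ b) c ⟩
    (a ∧ᴱ b) [] * c []        ≈⟨ *-cong (∧-[] a b) refl ⟩
    (a [] * b []) * c []      ≈⟨ *-assoc _ _ _ ⟩
    a [] * (b [] * c [])      ≈⟨ *-cong refl (∧-[] b c) ⟨
    a [] * (b ∧ᴱ c) []        ≈⟨ ∧-[] a (b ∧ᴱ c) ⟨
    (a ∧ᴱ (b ∧ᴱ c)) []        ∎
  ∧-assoc {suc n} a b c (outside ∷ Z) = begin
    ((a ∧ᴱ b) ∧ᴱ c) (outside ∷ Z)            ≈⟨ ∧-outside _ _ Z ⟩
    (part₀ (a ∧ᴱ b) ∧ᴱ part₀ c) Z            ≈⟨ ∧-cong (∧-outside a b) ≈ᴱ-refl Z ⟩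
    ((part₀ a ∧ᴱ part₀ b) ∧ᴱ part₀ c) Z      ≈⟨ ∧-assoc (part₀ a) (part₀ b) (part₀ c) Z ⟩
    (part₀ a ∧ᴱ (part₀ b ∧ᴱ part₀ c)) Z      ≈⟨ ∧-cong ≈ᴱ-refl (∧-outside b c) Z ⟨
    (part₀ a ∧ᴱ part₀ (b ∧ᴱ c)) Z            ≈⟨ ∧-outside _ _ Z ⟨
    (a ∧ᴱ (b ∧ᴱ c)) (outside ∷ Z)            ∎
  ∧-assoc {suc n} a b c (inside ∷ Z) = begin
    ((a ∧ᴱ b) ∧ᴱ c) (inside ∷ Z)
      ≈⟨ ∧-inside _ _ Z ⟩
    (part₁ (a ∧ᴱ b) ∧ᴱ a₀c) Z + (α (part₀ (a ∧ᴱ b)) ∧ᴱ part₁ c) Z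
      ≈⟨ +-cong (∧-cong (∧-inside a b) ≈ᴱ-refl Z)
                (∧-cong (λ W → trans (*-cong refl (∧-outside a b W)) (α-∧ (part₀ a) (part₀ b) W)) ≈ᴱ-refl Z) ⟩
    (((part₁ a ∧ᴱ part₀ b) +ᴱ (αa₀ ∧ᴱ part₁ b)) ∧ᴱ a₀c) Z + ((αa₀ ∧ᴱ α (part₀ b)) ∧ᴱ part₁ c) Z
      ≈⟨ +-cong (∧-distribʳ _ _ _ Z) refl ⟩
    (((part₁ a ∧ᴱ part₀ b) ∧ᴱ a₀c) Z + ((αa₀ ∧ᴱ part₁ b) ∧ᴱ a₀c) Z) + ((αa₀ ∧ᴱ α (part₀ b)) ∧ᴱ part₁ c) Z
      ≈⟨ +-cong (+-cong (∧-assoc _ _ _ Z) (∧-assoc _ _ _ Z)) (∧-assoc _ _ _ Z) ⟩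
    ((part₁ a ∧ᴱ (part₀ b ∧ᴱ a₀c)) Z + (αa₀ ∧ᴱ (part₁ b ∧ᴱ a₀c)) Z) + (αa₀ ∧ᴱ (α (part₀ b) ∧ᴱ part₁ c)) Z
      ≈⟨ +-assoc _ _ _ ⟩
    (part₁ a ∧ᴱ (part₀ b ∧ᴱ a₀c)) Z + ((αa₀ ∧ᴱ (part₁ b ∧ᴱ a₀c)) Z + (αa₀ ∧ᴱ (α (part₀ b) ∧ᴱ part₁ c)) Z)
      ≈⟨ +-cong refl (∧-distribˡ _ _ _ Z) ⟨
    (part₁ a ∧ᴱ (part₀ b ∧ᴱ a₀c)) Z + (αa₀ ∧ᴱ ((part₁ b ∧ᴱ a₀c) +ᴱ (α (part₀ b) ∧ᴱ part₁ c))) Z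
      ≈⟨ +-cong (∧-cong ≈ᴱ-refl (∧-outside b c) Z) (∧-cong ≈ᴱ-refl (∧-inside b c) Z) ⟨
    (part₁ a ∧ᴱ part₀ (b ∧ᴱ c)) Z + (αa₀ ∧ᴱ part₁ (b ∧ᴱ c)) Z
      ≈⟨ ∧-inside _ _ Z ⟨
    (a ∧ᴱ (b ∧ᴱ c)) (inside ∷ Z) ∎
    where
    αa₀ = α (part₀ a)
    a₀c = part₀ c

  -- ∂(a₀ + e₀ ∧ a₁) = ∂a₀ + a₁ - e₀ ∧ ∂a₁, for a₀ = part₀ a and a₁ = part₁ a.
  ∂ : ∀ {n} → E n → E n
  ∂ {zero}  a []            = 0#
  ∂ {suc n} a (outside ∷ Z) = ∂ (part₀ a) Z + a (inside ∷ Z)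
  ∂ {suc n} a (inside ∷ Z)  = - ∂ (part₁ a) Z

  ∂-cong : ∀ {n} {a b : E n} → a ≈ᴱ b → ∂ a ≈ᴱ ∂ b
  ∂-cong {zero}  a≈b []            = refl
  ∂-cong {suc n} a≈b (outside ∷ Z) = +-cong (∂-cong (a≈b ∘ (outside ∷_)) Z) (a≈b (inside ∷ Z))
  ∂-cong {suc n} a≈b (inside ∷ Z)  = -‿cong (∂-cong (a≈b ∘ (inside ∷_)) Z)

  ∂-+ : ∀ {n} (a b : E n) → ∂ (a +ᴱ b) ≈ᴱ (∂ a +ᴱ ∂ b)
  ∂-+ {zero}  a b []            = sym (+-identityˡ 0#)
  ∂-+ {suc n} a b (outside ∷ Z) = trans (+-cong (∂-+ (part₀ a) (part₀ b) Z) refl) (interchange _ _ _ _)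
  ∂-+ {suc n} a b (inside ∷ Z)  = trans (-‿cong (∂-+ (part₁ a) (part₁ b) Z)) (sym (-‿+-comm _ _))

  ∂-neg : ∀ {n} (a : E n) → ∂ (-ᴱ a) ≈ᴱ (-ᴱ ∂ a)
  ∂-neg {zero}  a []            = sym -0#≈0#
  ∂-neg {suc n} a (outside ∷ Z) = trans (+-cong (∂-neg (part₀ a) Z) refl) (-‿+-comm _ _)
  ∂-neg {suc n} a (inside ∷ Z)  = -‿cong (∂-neg (part₁ a) Z)

  ∂-scalar : ∀ {n} r (a : E n) → ∂ (r ·ᴱ a) ≈ᴱ (r ·ᴱ ∂ a)
  ∂-scalar {zero}  r a []            = sym (zeroʳ r)
  ∂-scalar {suc n} r a (outside ∷ Z) = trans (+-cong (∂-scalar r (part₀ a) Z) refl) (sym (distribˡ r _ _))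
  ∂-scalar {suc n} r a (inside ∷ Z)  = trans (-‿cong (∂-scalar r (part₁ a) Z)) (-‿distribʳ-* r _)

  ∂-zero : ∀ {n} → ∂ {n} 0ᴱ ≈ᴱ 0ᴱ
  ∂-zero {zero}  []            = refl
  ∂-zero {suc n} (outside ∷ Z) = trans (+-cong (∂-zero Z) refl) (+-identityˡ 0#)
  ∂-zero {suc n} (inside ∷ Z)  = trans (-‿cong (∂-zero Z)) -0#≈0#

  ∂-α : ∀ {n} (a : E n) → ∂ (α a) ≈ᴱ (-ᴱ α (∂ a))
  ∂-α {zero}  a []            = sym (trans (-‿cong (zeroʳ _)) -0#≈0#)
  ∂-α {suc n} a (outside ∷ Z) = begin
    ∂ (α (part₀ a)) Z + (- sign ∣ Z ∣) * a (inside ∷ Z)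
      ≈⟨ +-cong (∂-α (part₀ a) Z) (sym (-‿distribˡ-* _ _)) ⟩
    - (sign ∣ Z ∣ * ∂ (part₀ a) Z) + - (sign ∣ Z ∣ * a (inside ∷ Z))
      ≈⟨ -‿+-comm _ _ ⟩
    - (sign ∣ Z ∣ * ∂ (part₀ a) Z + sign ∣ Z ∣ * a (inside ∷ Z))
      ≈⟨ -‿cong (distribˡ _ _ _) ⟨
    - (sign ∣ Z ∣ * (∂ (part₀ a) Z + a (inside ∷ Z))) ∎
  ∂-α {suc n} a (inside ∷ Z) = begin
    - ∂ (part₁ (α a)) Z             ≈⟨ -‿cong (∂-cong (part₁-α a) Z) ⟩
    - ∂ (-ᴱ α (part₁ a)) Z          ≈⟨ -‿cong (∂-neg _ Z) ⟩
    - - ∂ (α (part₁ a)) Z           ≈⟨ -‿involutive _ ⟩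
    ∂ (α (part₁ a)) Z               ≈⟨ ∂-α (part₁ a) Z ⟩
    - (sign ∣ Z ∣ * ∂ (part₁ a) Z)  ≈⟨ -‿cong (-x*-y≈x*y _ _) ⟨
    - ((- sign ∣ Z ∣) * (- ∂ (part₁ a) Z)) ∎

  regroup-cross-term : ∀ p q r s t → - ((p + q) + (- r + s)) ≈ (- p + (r + t)) + (- (q + t) + - s)
  regroup-cross-term p q r s t = begin
    - ((p + q) + (- r + s))
      ≈⟨ -‿+-comm _ _ ⟨
    - (p + q) + - (- r + s)
      ≈⟨ +-cong (sym (-‿+-comm p q)) (trans (sym (-‿+-comm (- r) s)) (+-cong (-‿involutive r) refl)) ⟩
    (- p + - q) + (r + - s)
      ≈⟨ +-identityʳ _ ⟨
    ((- p + - q) + (r + - s)) + 0#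
      ≈⟨ +-cong refl (-‿inverseʳ t) ⟨
    ((- p + - q) + (r + - s)) + (t + - t)
      ≈⟨ +-Solver.prove 6 (((P ⊕ Q) ⊕ (R ⊕ S)) ⊕ (T ⊕ T′)) ((P ⊕ (R ⊕ T)) ⊕ ((Q ⊕ T′) ⊕ S))
                          (- p ∷ - q ∷ r ∷ - s ∷ t ∷ - t ∷ []) ⟩
    (- p + (r + t)) + ((- q + - t) + - s)
      ≈⟨ +-cong refl (+-cong (-‿+-comm q t) refl) ⟩
    (- p + (r + t)) + (- (q + t) + - s) ∎
    where
    open +-Solver using (_⊕_; var)
    P = var (# 0)
    Q = var (# 1)
    R = var (# 2)
    S = var (# 3)
    T = var (# 4)
    T′ = var (# 5)

  ∂-leibniz : ∀ {n} (a b : E n) → ∂ (a ∧ᴱ b) ≈ᴱ ((∂ a ∧ᴱ b) +ᴱ (α a ∧ᴱ ∂ b))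
  ∂-leibniz {zero} a b [] = sym (begin
    (∂ a ∧ᴱ b) [] + (α a ∧ᴱ ∂ b) []   ≈⟨ +-cong (∧-[] (∂ a) b) (∧-[] (α a) (∂ b)) ⟩
    0# * b [] + α a [] * 0#           ≈⟨ +-cong (zeroˡ _) (zeroʳ _) ⟩
    0# + 0#                           ≈⟨ +-identityˡ 0# ⟩
    0#                                ∎)
  ∂-leibniz {suc n} a b (outside ∷ Z) = begin
    ∂ (part₀ (a ∧ᴱ b)) Z + (a ∧ᴱ b) (inside ∷ Z)
      ≈⟨ +-cong (∂-cong (∧-outside a b) Z) (∧-inside a b Z) ⟩
    ∂ (a₀ ∧ᴱ b₀) Z + ((a₁ ∧ᴱ b₀) Z + (α a₀ ∧ᴱ b₁) Z)
      ≈⟨ +-cong (∂-leibniz a₀ b₀ Z) refl ⟩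
    ((∂ a₀ ∧ᴱ b₀) Z + (α a₀ ∧ᴱ ∂ b₀) Z) + ((a₁ ∧ᴱ b₀) Z + (α a₀ ∧ᴱ b₁) Z)
      ≈⟨ interchange _ _ _ _ ⟩
    ((∂ a₀ ∧ᴱ b₀) Z + (a₁ ∧ᴱ b₀) Z) + ((α a₀ ∧ᴱ ∂ b₀) Z + (α a₀ ∧ᴱ b₁) Z)
      ≈⟨ +-cong (∧-distribʳ _ _ _ Z) (∧-distribˡ _ _ _ Z) ⟨
    (part₀ (∂ a) ∧ᴱ b₀) Z + (part₀ (α a) ∧ᴱ part₀ (∂ b)) Z
      ≈⟨ +-cong (∧-outside _ _ Z) (∧-outside _ _ Z) ⟨
    (∂ a ∧ᴱ b) (outside ∷ Z) + (α a ∧ᴱ ∂ b) (outside ∷ Z) ∎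
    where
    a₀ = part₀ a
    a₁ = part₁ a
    b₀ = part₀ b
    b₁ = part₁ b
  ∂-leibniz {suc n} a b (inside ∷ Z) = begin
    - ∂ (part₁ (a ∧ᴱ b)) Z
      ≈⟨ -‿cong (∂-cong (∧-inside a b) Z) ⟩
    - ∂ ((a₁ ∧ᴱ b₀) +ᴱ (α a₀ ∧ᴱ b₁)) Z
      ≈⟨ -‿cong (∂-+ _ _ Z) ⟩
    - (∂ (a₁ ∧ᴱ b₀) Z + ∂ (α a₀ ∧ᴱ b₁) Z)
      ≈⟨ -‿cong (+-cong (∂-leibniz _ _ Z) (∂-leibniz _ _ Z)) ⟩
    - (((∂ a₁ ∧ᴱ b₀) Z + (α a₁ ∧ᴱ ∂ b₀) Z) + ((∂ (α a₀) ∧ᴱ b₁) Z + (α (α a₀) ∧ᴱ ∂ b₁) Z))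
      ≈⟨ -‿cong (+-cong refl (+-cong (trans (∧-cong (∂-α a₀) ≈ᴱ-refl Z) (∧-negˡ _ _ Z)) refl)) ⟩
    - (((∂ a₁ ∧ᴱ b₀) Z + (α a₁ ∧ᴱ ∂ b₀) Z) + (- (α (∂ a₀) ∧ᴱ b₁) Z + (α (α a₀) ∧ᴱ ∂ b₁) Z))
      -- α a₁ ∧ b₁ occurs in both α (part₀ (∂ a)) ∧ b₁ and part₁ (α a) ∧ part₀ (∂ b).
      ≈⟨ regroup-cross-term _ _ _ _ ((α a₁ ∧ᴱ b₁) Z) ⟩
    (- (∂ a₁ ∧ᴱ b₀) Z + ((α (∂ a₀) ∧ᴱ b₁) Z + (α a₁ ∧ᴱ b₁) Z))
      + (- ((α a₁ ∧ᴱ ∂ b₀) Z + (α a₁ ∧ᴱ b₁) Z) + - (α (α a₀) ∧ᴱ ∂ b₁) Z)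
      ≈⟨ +-cong (+-cong (∧-negˡ _ _ Z) (trans (∧-cong (λ W → distribˡ _ _ _) ≈ᴱ-refl Z) (∧-distribʳ _ _ _ Z)))
                (+-cong (trans (∧-cong (part₁-α a) ≈ᴱ-refl Z) (trans (∧-negˡ _ _ Z) (-‿cong (∧-distribˡ _ _ _ Z))))
                        (∧-negʳ _ _ Z)) ⟨
    ((part₁ (∂ a) ∧ᴱ b₀) Z + (α (part₀ (∂ a)) ∧ᴱ b₁) Z)
      + ((part₁ (α a) ∧ᴱ part₀ (∂ b)) Z + (α (part₀ (α a)) ∧ᴱ part₁ (∂ b)) Z)
      ≈⟨ +-cong (∧-inside _ _ Z) (∧-inside _ _ Z) ⟨
    (∂ a ∧ᴱ b) (inside ∷ Z) + (α a ∧ᴱ ∂ b) (inside ∷ Z) ∎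
    where
    a₀ = part₀ a
    a₁ = part₁ a
    b₀ = part₀ b
    b₁ = part₁ b

  module _ {n : ℕ} (X : Subset n) where

    part₀-e-outside : part₀ (e (outside ∷ X)) ≈ᴱ e X
    part₀-e-outside = e-∷ outside X

    part₀-e-inside : part₀ (e (inside ∷ X)) ≈ᴱ 0ᴱ
    part₀-e-inside Z = e-∷-≢ inside outside X Z λ ()

    part₁-e-inside : part₁ (e (inside ∷ X)) ≈ᴱ e X
    part₁-e-inside = e-∷ inside X

    part₁-e-outside : part₁ (e (outside ∷ X)) ≈ᴱ 0ᴱ
    part₁-e-outside Z = e-∷-≢ outside inside X Z λ ()

    α-e : α (e X) ≈ᴱ (sign ∣ X ∣ ·ᴱ e X)
    α-e Z = on (Z ≟ₛ X)
      where
      on : Dec (Z ≡ X) → sign ∣ Z ∣ * e X Z ≈ sign ∣ X ∣ * e X Z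
      on (yes Z≡X) = *-cong (reflexive (≡.cong (sign ∘ ∣_∣) Z≡X)) refl
      on (no Z≢X)  = trans (x≈0⇒y*x≈0 _ (e-≢ X Z Z≢X)) (sym (x≈0⇒y*x≈0 _ (e-≢ X Z Z≢X)))

  𝟙 : ∀ {n} → E n
  𝟙 = e ⊥

  α-𝟙 : ∀ {n} → α {n} 𝟙 ≈ᴱ 𝟙
  α-𝟙 {n} Z = trans (α-e ⊥ Z) (trans (*-cong (reflexive (≡.cong sign (∣⊥∣≡0 n))) refl) (*-identityˡ _))

  ∧-identityˡ : ∀ {n} (a : E n) → (𝟙 ∧ᴱ a) ≈ᴱ a
  ∧-identityˡ {zero}  a []            = trans (∧-[] 𝟙 a) (*-identityˡ _)
  ∧-identityˡ {suc n} a (outside ∷ Z) =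
    trans (∧-outside 𝟙 a Z) (trans (∧-cong (part₀-e-outside ⊥) ≈ᴱ-refl Z) (∧-identityˡ (part₀ a) Z))
  ∧-identityˡ {suc n} a (inside ∷ Z)  = begin
    (𝟙 ∧ᴱ a) (inside ∷ Z)
      ≈⟨ ∧-inside 𝟙 a Z ⟩
    (part₁ 𝟙 ∧ᴱ part₀ a) Z + (α (part₀ 𝟙) ∧ᴱ part₁ a) Z
      ≈⟨ +-cong (trans (∧-cong (part₁-e-outside ⊥) ≈ᴱ-refl Z) (∧-zeroˡ _ Z))
                (trans (∧-cong (λ W → trans (α-cong (part₀-e-outside ⊥) W) (α-𝟙 W)) ≈ᴱ-refl Z) (∧-identityˡ (part₁ a) Z)) ⟩
    0# + a (inside ∷ Z)
      ≈⟨ +-identityˡ _ ⟩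
    a (inside ∷ Z) ∎

  ∧-identityʳ : ∀ {n} (a : E n) → (a ∧ᴱ 𝟙) ≈ᴱ a
  ∧-identityʳ {zero}  a []            = trans (∧-[] a 𝟙) (*-identityʳ _)
  ∧-identityʳ {suc n} a (outside ∷ Z) =
    trans (∧-outside a 𝟙 Z) (trans (∧-cong ≈ᴱ-refl (part₀-e-outside ⊥) Z) (∧-identityʳ (part₀ a) Z))
  ∧-identityʳ {suc n} a (inside ∷ Z)  = begin
    (a ∧ᴱ 𝟙) (inside ∷ Z)
      ≈⟨ ∧-inside a 𝟙 Z ⟩
    (part₁ a ∧ᴱ part₀ 𝟙) Z + (α (part₀ a) ∧ᴱ part₁ 𝟙) Z
      ≈⟨ +-cong (trans (∧-cong ≈ᴱ-refl (part₀-e-outside ⊥) Z) (∧-identityʳ (part₁ a) Z))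
                (trans (∧-cong ≈ᴱ-refl (part₁-e-outside ⊥) Z) (∧-zeroʳ _ Z)) ⟩
    a (inside ∷ Z) + 0#
      ≈⟨ +-identityʳ _ ⟩
    a (inside ∷ Z) ∎

  e∧e≈eWedge : ∀ {n} (X Y : Subset n) → (e X ∧ᴱ e Y) ≈ᴱ eWedge X Y
  e∧e≈eWedge {zero} [] [] [] = ∧-[] (e []) (e [])
  e∧e≈eWedge {suc n} (inside ∷ X) (y ∷ Y) (outside ∷ Z) =
    trans (∧-outside _ _ Z) (trans (∧-cong (part₀-e-inside X) ≈ᴱ-refl Z) (trans (∧-zeroˡ _ Z) (sym (vanishes y))))
    where
    vanishes : ∀ y → eWedge (inside ∷ X) (y ∷ Y) (outside ∷ Z) ≈ 0#
    vanishes inside  = refl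
    vanishes outside = guardedBasis-∷-≢ (disjoint? X Y) _ inside outside (X ∪ Y) Z λ ()
  e∧e≈eWedge {suc n} (outside ∷ X) (inside ∷ Y) (outside ∷ Z) =
    trans (∧-outside _ _ Z) (trans (∧-cong ≈ᴱ-refl (part₀-e-inside Y) Z)
      (trans (∧-zeroʳ _ Z) (sym (guardedBasis-∷-≢ (disjoint? X Y) _ inside outside (X ∪ Y) Z λ ()))))
  e∧e≈eWedge {suc n} (outside ∷ X) (outside ∷ Y) (outside ∷ Z) =
    trans (∧-outside _ _ Z) (trans (∧-cong (part₀-e-outside X) (part₀-e-outside Y) Z)
      (trans (e∧e≈eWedge X Y Z) (sym (eWedge-∷-outside outside X Y Z))))
  e∧e≈eWedge {suc n} (inside ∷ X) (inside ∷ Y) (inside ∷ Z) =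
    trans (∧-inside _ _ Z) (trans (+-cong (trans (∧-cong ≈ᴱ-refl (part₀-e-inside Y) Z) (∧-zeroʳ _ Z))
                                          (trans (∧-cong (λ W → trans (α-cong (part₀-e-inside X) W) (α-zero W)) ≈ᴱ-refl Z)
                                                 (∧-zeroˡ _ Z)))
                                  (+-identityˡ 0#))
  e∧e≈eWedge {suc n} (inside ∷ X) (outside ∷ Y) (inside ∷ Z) =
    trans (∧-inside _ _ Z) (trans (+-cong (trans (∧-cong (part₁-e-inside X) (part₀-e-outside Y) Z) (e∧e≈eWedge X Y Z))
                                          (trans (∧-cong ≈ᴱ-refl (part₁-e-outside Y) Z) (∧-zeroʳ _ Z)))
                                  (trans (+-identityʳ _) (sym (eWedge-∷-outside inside X Y Z))))
  e∧e≈eWedge {suc n} (outside ∷ X) (inside ∷ Y) (inside ∷ Z) =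
    trans (∧-inside _ _ Z) (trans (+-cong (trans (∧-cong (part₁-e-outside X) ≈ᴱ-refl Z) (∧-zeroˡ _ Z))
                                          (trans (∧-cong (λ W → trans (α-cong (part₀-e-outside X) W) (α-e X W)) (part₁-e-inside Y) Z)
                                                 (trans (∧-scalarˡ _ _ _ Z) (*-cong refl (e∧e≈eWedge X Y Z)))))
                                  (trans (+-identityˡ _) (sym (eWedge-outside-inside X Y Z))))
  e∧e≈eWedge {suc n} (outside ∷ X) (outside ∷ Y) (inside ∷ Z) =
    trans (∧-inside _ _ Z) (trans (+-cong (trans (∧-cong (part₁-e-outside X) ≈ᴱ-refl Z) (∧-zeroˡ _ Z))
                                          (trans (∧-cong ≈ᴱ-refl (part₁-e-outside Y) Z) (∧-zeroʳ _ Z)))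
                                  (trans (+-identityˡ 0#) (sym (guardedBasis-∷-≢ (disjoint? X Y) _ outside inside (X ∪ Y) Z λ ()))))

  e∧e-disjoint : ∀ {n} (X Y : Subset n) → disjoint? X Y ≡ true →
    (e X ∧ᴱ e Y) ≈ᴱ (sign (inversions X Y) ·ᴱ e (X ∪ Y))
  e∧e-disjoint X Y X#Y Z = trans (e∧e≈eWedge X Y Z) (eWedge-disjoint X#Y)
    where
    eWedge-disjoint : disjoint? X Y ≡ true → eWedge X Y Z ≈ sign (inversions X Y) * e (X ∪ Y) Z
    eWedge-disjoint X#Y rewrite X#Y = *-cong (sgn≈sign (inversions X Y)) refl

  ∂e-term : ∀ {n} → Subset n → Fin n → E n
  ∂e-term {n} X i = guardedBasis (lookup X i) (Ext.sgn {n} (below i X)) (X ─ ⁅ i ⁆)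

  ∂e-as-sum : ∀ {n} (X Z : Subset n) → ∂e X Z ≡ sumMap (λ i → ∂e-term X i Z) (allFin n)
  ∂e-as-sum {n} X Z = ≡.trans (sumᴱ-at (map (∂e-term X) (allFin n)) Z) (sumMap-map (λ a → a Z) (∂e-term X) (allFin n))

  sum-∂e-term≈∂∘e : ∀ {n} (X Z : Subset n) → sumMap (λ i → ∂e-term X i Z) (allFin n) ≈ ∂ (e X) Z
  sum-∂e-term≈∂∘e [] [] = refl
  sum-∂e-term≈∂∘e {suc n} (inside ∷ X) (outside ∷ Z) = begin
    sumMap (λ i → ∂e-term (inside ∷ X) i (outside ∷ Z)) (allFin (suc n))
      ≡⟨ sumMap-allFin-suc (λ i → ∂e-term (inside ∷ X) i (outside ∷ Z)) ⟩
    ∂e-term (inside ∷ X) zero (outside ∷ Z) + sumMap (λ j → ∂e-term (inside ∷ X) (suc j) (outside ∷ Z)) (allFin n)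
      ≈⟨ +-cong (trans (guardedBasis-∷ true _ outside (X ─ ⊥) Z) (trans (*-identityˡ _) (reflexive (≡.cong (λ V → e V Z) (p─⊥≡p X)))))
                (sumMap-zero (allFin n) (λ j → guardedBasis-∷-≢ (lookup X j) _ inside outside (X ─ ⁅ j ⁆) Z λ ())) ⟩
    e X Z + 0#
      ≈⟨ +-comm _ _ ⟩
    0# + e X Z
      ≈⟨ +-cong (trans (∂-cong (part₀-e-inside X) Z) (∂-zero Z)) (part₁-e-inside X Z) ⟨
    ∂ (part₀ (e (inside ∷ X))) Z + e (inside ∷ X) (inside ∷ Z) ∎
  sum-∂e-term≈∂∘e {suc n} (inside ∷ X) (inside ∷ Z) = begin
    sumMap (λ i → ∂e-term (inside ∷ X) i (inside ∷ Z)) (allFin (suc n))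
      ≡⟨ sumMap-allFin-suc (λ i → ∂e-term (inside ∷ X) i (inside ∷ Z)) ⟩
    ∂e-term (inside ∷ X) zero (inside ∷ Z) + sumMap (λ j → ∂e-term (inside ∷ X) (suc j) (inside ∷ Z)) (allFin n)
      ≈⟨ +-cong (guardedBasis-∷-≢ true _ outside inside (X ─ ⊥) Z λ ()) (sumMap-cong (allFin n) shifted) ⟩
    0# + sumMap (λ j → - 1# * ∂e-term X j Z) (allFin n)
      ≈⟨ +-identityˡ _ ⟩
    sumMap (λ j → - 1# * ∂e-term X j Z) (allFin n)
      ≈⟨ sumMap-*ˡ (- 1#) _ (allFin n) ⟩
    - 1# * sumMap (λ j → ∂e-term X j Z) (allFin n)
      ≈⟨ -1*x≈-x _ ⟩
    - sumMap (λ j → ∂e-term X j Z) (allFin n)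
      ≈⟨ -‿cong (sum-∂e-term≈∂∘e X Z) ⟩
    - ∂ (e X) Z
      ≈⟨ -‿cong (∂-cong (part₁-e-inside X) Z) ⟨
    - ∂ (part₁ (e (inside ∷ X))) Z ∎
    where
    shifted : ∀ j → ∂e-term (inside ∷ X) (suc j) (inside ∷ Z) ≈ - 1# * ∂e-term X j Z
    shifted j = begin
      guardedBasis (lookup X j) (Ext.sgn {suc n} (suc (below j X))) (inside ∷ (X ─ ⁅ j ⁆)) (inside ∷ Z)
        ≈⟨ guardedBasis-∷ (lookup X j) _ inside (X ─ ⁅ j ⁆) Z ⟩
      guardedBasis (lookup X j) (Ext.sgn {suc n} (suc (below j X))) (X ─ ⁅ j ⁆) Z
        ≈⟨ guardedBasis-cong (lookup X j) (X ─ ⁅ j ⁆) Z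
             (trans (-‿cong (sgn-indep {suc n} {n} (below j X))) (sym (-1*x≈-x _))) ⟩
      guardedBasis (lookup X j) (- 1# * Ext.sgn {n} (below j X)) (X ─ ⁅ j ⁆) Z
        ≈⟨ guardedBasis-* (lookup X j) _ _ (X ─ ⁅ j ⁆) Z ⟩
      - 1# * ∂e-term X j Z ∎
  sum-∂e-term≈∂∘e {suc n} (outside ∷ X) (outside ∷ Z) = begin
    sumMap (λ i → ∂e-term (outside ∷ X) i (outside ∷ Z)) (allFin (suc n))
      ≡⟨ sumMap-allFin-suc (λ i → ∂e-term (outside ∷ X) i (outside ∷ Z)) ⟩
    0# + sumMap (λ j → ∂e-term (outside ∷ X) (suc j) (outside ∷ Z)) (allFin n)
      ≈⟨ +-identityˡ _ ⟩
    sumMap (λ j → ∂e-term (outside ∷ X) (suc j) (outside ∷ Z)) (allFin n)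
      ≈⟨ sumMap-cong (allFin n) (λ j → trans (guardedBasis-∷ (lookup X j) _ outside (X ─ ⁅ j ⁆) Z)
                                             (guardedBasis-cong (lookup X j) (X ─ ⁅ j ⁆) Z (sgn-indep {suc n} {n} (below j X)))) ⟩
    sumMap (λ j → ∂e-term X j Z) (allFin n)
      ≈⟨ sum-∂e-term≈∂∘e X Z ⟩
    ∂ (e X) Z
      ≈⟨ +-identityʳ _ ⟨
    ∂ (e X) Z + 0#
      ≈⟨ +-cong (∂-cong (part₀-e-outside X) Z) (part₁-e-outside X Z) ⟨
    ∂ (part₀ (e (outside ∷ X))) Z + e (outside ∷ X) (inside ∷ Z) ∎
  sum-∂e-term≈∂∘e {suc n} (outside ∷ X) (inside ∷ Z) = begin
    sumMap (λ i → ∂e-term (outside ∷ X) i (inside ∷ Z)) (allFin (suc n))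
      ≡⟨ sumMap-allFin-suc (λ i → ∂e-term (outside ∷ X) i (inside ∷ Z)) ⟩
    0# + sumMap (λ j → ∂e-term (outside ∷ X) (suc j) (inside ∷ Z)) (allFin n)
      ≈⟨ +-identityˡ _ ⟩
    sumMap (λ j → ∂e-term (outside ∷ X) (suc j) (inside ∷ Z)) (allFin n)
      ≈⟨ sumMap-zero (allFin n) (λ j → guardedBasis-∷-≢ (lookup X j) _ outside inside (X ─ ⁅ j ⁆) Z λ ()) ⟩
    0#
      ≈⟨ -0#≈0# ⟨
    - 0#
      ≈⟨ -‿cong (trans (∂-cong (part₁-e-outside X) Z) (∂-zero Z)) ⟨
    - ∂ (part₁ (e (outside ∷ X))) Z ∎

  ∂e≈∂∘e : ∀ {n} (X : Subset n) → ∂e X ≈ᴱ ∂ (e X)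
  ∂e≈∂∘e X Z = trans (reflexive (∂e-as-sum X Z)) (sum-∂e-term≈∂∘e X Z)

  ∂-𝟙 : ∀ {n} → ∂ {n} 𝟙 ≈ᴱ 0ᴱ
  ∂-𝟙 {zero}  []            = refl
  ∂-𝟙 {suc n} (outside ∷ Z) =
    trans (+-cong (trans (∂-cong (part₀-e-outside ⊥) Z) (∂-𝟙 Z)) (part₁-e-outside ⊥ Z)) (+-identityˡ 0#)
  ∂-𝟙 {suc n} (inside ∷ Z)  = trans (-‿cong (trans (∂-cong (part₁-e-outside ⊥) Z) (∂-zero Z))) -0#≈0#

  ∂-e⁅⁆ : ∀ {n} (i : Fin n) → ∂ (e ⁅ i ⁆) ≈ᴱ 𝟙
  ∂-e⁅⁆ zero    (outside ∷ Z) =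
    trans (+-cong (trans (∂-cong (part₀-e-inside ⊥) Z) (∂-zero Z)) (part₁-e-inside ⊥ Z))
          (trans (+-identityˡ _) (sym (part₀-e-outside ⊥ Z)))
  ∂-e⁅⁆ zero    (inside ∷ Z)  =
    trans (-‿cong (trans (∂-cong (part₁-e-inside ⊥) Z) (∂-𝟙 Z))) (trans -0#≈0# (sym (part₁-e-outside ⊥ Z)))
  ∂-e⁅⁆ (suc i) (outside ∷ Z) =
    trans (+-cong (trans (∂-cong (part₀-e-outside ⁅ i ⁆) Z) (∂-e⁅⁆ i Z)) (part₁-e-outside ⁅ i ⁆ Z))
          (trans (+-identityʳ _) (sym (part₀-e-outside ⊥ Z)))
  ∂-e⁅⁆ (suc i) (inside ∷ Z)  =
    trans (-‿cong (trans (∂-cong (part₁-e-outside ⁅ i ⁆) Z) (∂-zero Z))) (trans -0#≈0# (sym (part₁-e-outside ⊥ Z)))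

  α-e⁅⁆ : ∀ {n} (i : Fin n) → α (e ⁅ i ⁆) ≈ᴱ (-ᴱ e ⁅ i ⁆)
  α-e⁅⁆ i Z = trans (α-e ⁅ i ⁆ Z) (trans (*-cong (reflexive (≡.cong sign (∣⁅x⁆∣≡1 i))) refl) (-1*x≈-x _))

  -- After expanding both ∂(w ∧ v) and ∂(u ∧ w) by Leibniz, the two terms ±∂u ∧ w ∧ ∂v cancel.
  ∂-∧-through : ∀ {n} (u v w : E n) → ∂ w ≈ᴱ 𝟙 → α w ≈ᴱ (-ᴱ w) →
    ∂ (u ∧ᴱ v) ≈ᴱ ((∂ u ∧ᴱ ∂ (w ∧ᴱ v)) +ᴱ (∂ (u ∧ᴱ w) ∧ᴱ ∂ v))
  ∂-∧-through u v w ∂w≈𝟙 αw≈-w Z = sym (begin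
    (∂ u ∧ᴱ ∂ (w ∧ᴱ v)) Z + (∂ (u ∧ᴱ w) ∧ᴱ ∂ v) Z
      ≈⟨ +-cong (∧-cong ≈ᴱ-refl ∂[w∧v] Z) (∧-cong ∂[u∧w] ≈ᴱ-refl Z) ⟩
    (∂ u ∧ᴱ (v +ᴱ (-ᴱ (w ∧ᴱ ∂ v)))) Z + (((∂ u ∧ᴱ w) +ᴱ α u) ∧ᴱ ∂ v) Z
      ≈⟨ +-cong (trans (∧-distribˡ _ _ _ Z) (+-cong refl (∧-negʳ _ _ Z))) (∧-distribʳ _ _ _ Z) ⟩
    ((∂ u ∧ᴱ v) Z + - (∂ u ∧ᴱ (w ∧ᴱ ∂ v)) Z) + (((∂ u ∧ᴱ w) ∧ᴱ ∂ v) Z + (α u ∧ᴱ ∂ v) Z)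
      ≈⟨ +-cong refl (+-cong (∧-assoc _ _ _ Z) refl) ⟩
    ((∂ u ∧ᴱ v) Z + - (∂ u ∧ᴱ (w ∧ᴱ ∂ v)) Z) + ((∂ u ∧ᴱ (w ∧ᴱ ∂ v)) Z + (α u ∧ᴱ ∂ v) Z)
      ≈⟨ cancel-middle _ _ _ ⟩
    (∂ u ∧ᴱ v) Z + (α u ∧ᴱ ∂ v) Z
      ≈⟨ ∂-leibniz u v Z ⟨
    ∂ (u ∧ᴱ v) Z ∎)
    where
    ∂[w∧v] : ∂ (w ∧ᴱ v) ≈ᴱ (v +ᴱ (-ᴱ (w ∧ᴱ ∂ v)))
    ∂[w∧v] W = trans (∂-leibniz w v W)
      (+-cong (trans (∧-cong ∂w≈𝟙 ≈ᴱ-refl W) (∧-identityˡ v W)) (trans (∧-cong αw≈-w ≈ᴱ-refl W) (∧-negˡ _ _ W)))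
    ∂[u∧w] : ∂ (u ∧ᴱ w) ≈ᴱ ((∂ u ∧ᴱ w) +ᴱ α u)
    ∂[u∧w] W = trans (∂-leibniz u w W) (+-cong refl (trans (∧-cong ≈ᴱ-refl ∂w≈𝟙 W) (∧-identityʳ _ W)))
    cancel-middle : ∀ a m b → (a + - m) + (m + b) ≈ a + b
    cancel-middle a m b = begin
      (a + - m) + (m + b)   ≈⟨ +-assoc _ _ _ ⟩
      a + (- m + (m + b))   ≈⟨ +-cong refl (+-assoc _ _ _) ⟨
      a + ((- m + m) + b)   ≈⟨ +-cong refl (+-cong (-‿inverseˡ m) refl) ⟩
      a + (0# + b)          ≈⟨ +-cong refl (+-identityˡ b) ⟩
      a + b                 ∎

  ∂-e∧e : ∀ {n} (X Y : Subset n) → disjoint? X Y ≡ true →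
    ∂ (e X ∧ᴱ e Y) ≈ᴱ (sign (inversions X Y) ·ᴱ ∂e (X ∪ Y))
  ∂-e∧e X Y X#Y Z = trans (∂-cong (e∧e-disjoint X Y X#Y) Z)
    (trans (∂-scalar _ _ Z) (*-cong refl (sym (∂e≈∂∘e (X ∪ Y) Z))))

  Ideal-least : ∀ {n} {𝔛 𝔜 : Subset n → Set} → (∀ {X} → 𝔛 X → Ideal 𝔜 (∂e X)) → ∀ {a} → Ideal 𝔛 a → Ideal 𝔜 a
  Ideal-least 𝔛⊆𝔜 (gen X∈𝔛)   = 𝔛⊆𝔜 X∈𝔛
  Ideal-least 𝔛⊆𝔜 Ext.zer      = Ext.zer
  Ideal-least 𝔛⊆𝔜 (add p q)    = add (Ideal-least 𝔛⊆𝔜 p) (Ideal-least 𝔛⊆𝔜 q)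
  Ideal-least 𝔛⊆𝔜 (lmul a p)   = lmul a (Ideal-least 𝔛⊆𝔜 p)
  Ideal-least 𝔛⊆𝔜 (rmul b p)   = rmul b (Ideal-least 𝔛⊆𝔜 p)
  Ideal-least 𝔛⊆𝔜 (resp a≈b p) = resp a≈b (Ideal-least 𝔛⊆𝔜 p)

  module _ {n : ℕ} {𝔛 : Subset n → Set} where

    Ideal-scalar : ∀ r {a} → Ideal 𝔛 a → Ideal 𝔛 (r ·ᴱ a)
    Ideal-scalar r {a} a∈I =
      resp (λ Z → trans (∧-scalarˡ r 𝟙 a Z) (*-cong refl (∧-identityˡ a Z))) (lmul (r ·ᴱ 𝟙) a∈I)

    Ideal-∂e⇒∂-e∧e : ∀ X Y → disjoint? X Y ≡ true → Ideal 𝔛 (∂e (X ∪ Y)) → Ideal 𝔛 (∂ (e X ∧ᴱ e Y))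
    Ideal-∂e⇒∂-e∧e X Y X#Y ∂e∈I =
      resp (λ Z → sym (∂-e∧e X Y X#Y Z)) (Ideal-scalar (sign (inversions X Y)) ∂e∈I)

    Ideal-∂-e∧e⇒∂e : ∀ X Y → disjoint? X Y ≡ true → Ideal 𝔛 (∂ (e X ∧ᴱ e Y)) → Ideal 𝔛 (∂e (X ∪ Y))
    Ideal-∂-e∧e⇒∂e X Y X#Y ∂e∧e∈I = resp sign-cancels (Ideal-scalar σ ∂e∧e∈I)
      where
      σ = sign (inversions X Y)
      sign-cancels : (σ ·ᴱ ∂ (e X ∧ᴱ e Y)) ≈ᴱ ∂e (X ∪ Y)
      sign-cancels Z = begin
        σ * ∂ (e X ∧ᴱ e Y) Z       ≈⟨ *-cong refl (∂-e∧e X Y X#Y Z) ⟩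
        σ * (σ * ∂e (X ∪ Y) Z)     ≈⟨ *-assoc _ _ _ ⟨
        (σ * σ) * ∂e (X ∪ Y) Z     ≈⟨ *-cong (sign*sign≈1 (inversions X Y)) refl ⟩
        1# * ∂e (X ∪ Y) Z          ≈⟨ *-identityˡ _ ⟩
        ∂e (X ∪ Y) Z               ∎

    ∂e-Δ∈Ideal : ∀ {i} (C₁ C₂ : Subset n) → C₁ ∩ C₂ ≡ ⁅ i ⁆ →
      Ideal 𝔛 (∂e C₁) → Ideal 𝔛 (∂e C₂) → Ideal 𝔛 (∂e (C₁ Δ C₂))
    ∂e-Δ∈Ideal {i} C₁ C₂ C₁∩C₂≡i ∂eC₁∈I ∂eC₂∈I =
      ≡.subst (Ideal 𝔛 ∘ ∂e) (≡.sym (split-Δ C₁ C₂))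
        (Ideal-∂-e∧e⇒∂e A B (disjoint-─∩-─∩ C₁ C₂)
          (resp (λ Z → sym (∂-∧-through (e A) (e B) (e M) ∂eM≈𝟙 αeM≈-eM Z))
                (add (lmul (∂ (e A)) ∂[eM∧eB]∈I) (rmul (∂ (e B)) ∂[eA∧eM]∈I))))
      where
      M = C₁ ∩ C₂
      A = C₁ ─ M
      B = C₂ ─ M
      ∂eM≈𝟙 : ∂ (e M) ≈ᴱ 𝟙
      ∂eM≈𝟙 = ≡.subst (λ V → ∂ (e V) ≈ᴱ 𝟙) (≡.sym C₁∩C₂≡i) (∂-e⁅⁆ i)
      αeM≈-eM : α (e M) ≈ᴱ (-ᴱ e M)
      αeM≈-eM = ≡.subst (λ V → α (e V) ≈ᴱ (-ᴱ e V)) (≡.sym C₁∩C₂≡i) (α-e⁅⁆ i)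
      ∂[eA∧eM]∈I : Ideal 𝔛 (∂ (e A ∧ᴱ e M))
      ∂[eA∧eM]∈I = Ideal-∂e⇒∂-e∧e A M (disjoint-─∩-∩ C₁ C₂) (≡.subst (Ideal 𝔛 ∘ ∂e) (split-∩ˡ C₁ C₂) ∂eC₁∈I)
      ∂[eM∧eB]∈I : Ideal 𝔛 (∂ (e M ∧ᴱ e B))
      ∂[eM∧eB]∈I = Ideal-∂e⇒∂-e∧e M B (disjoint-∩-─∩ C₁ C₂) (≡.subst (Ideal 𝔛 ∘ ∂e) (split-∩ʳ C₁ C₂) ∂eC₂∈I)

  module _ {n} (M : Matroid n) (ℓ : ℕ) (simple : Simple M) (chordal : Chordal M ℓ) where
    open Matroid M

    circuit∈Ideal : ∀ C → IsCircuit C → Ideal (CircuitsUpTo M (ℓ ∸ 1)) (∂e C)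
    circuit∈Ideal = All.wfRec (wellFounded ∣_∣ <-wellFounded) _ _ step
      where
      step : ∀ C → (∀ {D} → ∣ D ∣ < ∣ C ∣ → IsCircuit D → Ideal (CircuitsUpTo M (ℓ ∸ 1)) (∂e D)) →
             IsCircuit C → Ideal (CircuitsUpTo M (ℓ ∸ 1)) (∂e C)
      step C smaller⇒∈I C-circuit with ∣ C ∣ ℕ.≤? ℓ ∸ 1
      ... | yes small = gen (C-circuit , small)
      ... | no large  with chordal C C-circuit (≤-trans (m≤n+m∸n ℓ 1) (≰⇒> large))
      ... | i , C₁ , C₂ , C₁-circuit , C₂-circuit , C₁∩C₂≡i , ≡.refl =
        ∂e-Δ∈Ideal C₁ C₂ C₁∩C₂≡i
          (smaller⇒∈I (∣p∣<∣pΔq∣ C₁∩C₂≡i (simple C₂ C₂-circuit)) C₁-circuit)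
          (smaller⇒∈I (∣q∣<∣pΔq∣ C₁∩C₂≡i (simple C₁ C₁-circuit)) C₂-circuit)

corollary5 : ∀ {c ℓ' : Level} (n : ℕ) (M : Matroid n) (K : Field c ℓ') (ℓ : ℕ) →
    Simple M → 4 ≤ ℓ → Chordal M ℓ →
    Exterior.SameIdeal K n (Matroid.IsCircuit M) (CircuitsUpTo M (ℓ ∸ 1))
corollary5 n M K ℓ simple _ chordal a =
  Ideal-least (circuit∈Ideal M ℓ simple chordal _) , Ideal-least (Exterior.gen ∘ proj₁)
  where open ExteriorCalculus K
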